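{- Let $d\ge 1$ be an integer. There is no online algorithm with advice for online unit clustering in $\mathbb{Z}^d$ which serves optimally all request sequences of length at least $n$ while reading fewer than $\frac{d}{1+3d}\cdot n$ bits of advice on each of them; that is, any online algorithm with advice that serves every request sequence optimally must, for arbitrarily large $n$, read at least $\frac{d}{1+3d}\cdot n$ bits of advice on some request sequence of $n$ points.
   Context: Online unit clustering in $\mathbb{Z}^d$: points of the integer lattice $\mathbb{Z}^d$, with the $L_\infty$ distance, arrive one by one; upon arrival each point must be irrevocably assigned to a cluster (an existing one or a newly opened one), and every cluster must have $L_\infty$-diameter at most $1$. The cost is the number of clusters; serving a sequence optimally means using the offline minimum number of clusters. Online algorithm with advice (tape model): an oracle knowing the whole input writes an infinite binary advice tape, which the algorithm may read sequentially; the advice complexity is the number of bits read. -}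

module Defs where

open import Data.Nat using (ℕ; zero; suc; _≤_)
open import Data.Nat.Properties using (_≟_)
open import Data.Integer as ℤ using (ℤ; ∣_∣)
open import Data.Fin using (Fin)
open import Data.Bool using (Bool)
open import Data.List using (List; []; _∷_; _++_; [_]; map; upTo; length; zip; deduplicate)
open import Data.List.Membership.Propositional using (_∈_)
open import Data.Product using (_×_; _,_)
open import Relation.Binary.PropositionalEquality using (_≡_)

Point : ℕ → Set
Point d = Fin d → ℤ

Close : ∀ {d} → Point d → Point d → Set
Close p q = ∀ i → ∣ p i ℤ.- q i ∣ ≤ 1

-- A clustering of a request sequence σ: a list of cluster labels, one per
-- request (the i-th label is the cluster of the i-th point).
ValidClustering : ∀ {d} → List (Point d) → List ℕ → Set
ValidClustering σ ls =
  length ls ≡ length σ ×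
  (∀ {p q a b} → (p , a) ∈ zip σ ls → (q , b) ∈ zip σ ls → a ≡ b → Close p q)

cost : List ℕ → ℕ
cost ls = length (deduplicate _≟_ ls)

Optimal : ∀ {d} → List (Point d) → List ℕ → Set
Optimal σ ls = ValidClustering σ ls ×
  (∀ ls′ → ValidClustering σ ls′ → cost ls ≤ cost ls′)

-- One online step: a finite decision tree that may read advice bits
-- one at a time before irrevocably choosing a cluster label.
data Step : Set where
  decide  : ℕ → Step
  readBit : (Bool → Step) → Step

Tape : Set
Tape = ℕ → Bool

OnlineAlg : ℕ → Set
OnlineAlg d = List (Point d) → List Bool → Point d → Step

prefix : Tape → ℕ → List Bool
prefix φ k = map φ (upTo k)

exec : Step → Tape → ℕ → ℕ × ℕ
exec (decide ℓ)  φ pos = ℓ , pos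
exec (readBit f) φ pos = exec (f (φ pos)) φ (suc pos)

runFrom : ∀ {d} → OnlineAlg d → Tape → List (Point d) → ℕ → List (Point d) → List ℕ × ℕ
runFrom A φ hist pos [] = [] , pos
runFrom A φ hist pos (p ∷ ps) with exec (A hist (prefix φ pos) p) φ pos
... | ℓ , pos′ with runFrom A φ (hist ++ [ p ]) pos′ ps
...   | ls , k = ℓ ∷ ls , k

run : ∀ {d} → OnlineAlg d → Tape → List (Point d) → List ℕ × ℕ
run A φ σ = runFrom A φ [] 0 σ

{-# OPTIONS --safe #-}
module Submission where

-- Fix m gadgets, one per block of d secret bits, far apart from each other.  Gadget g
-- first receives a centre C and, for every axis i, the point Pᵢ = C + eᵢ; the request
-- sequences for the 2^(m d) secrets agree up to this point.  Then, for every i, bit 1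
-- sends Pᵢ twice more and bit 0 sends Mᵢ = C − eᵢ and Tᵢ = C + 2eᵢ.  The centres and the
-- Tᵢ are pairwise at distance ≥ 2, and the clustering with one cube around C and one
-- cube {Pᵢ, Tᵢ} per zero bit attains that many clusters; hence an optimal algorithm
-- must put Pᵢ into the cluster of C exactly when the bit is 1.  The labels given to the
-- common prefix therefore determine the secret, so the advice read on that prefix does
-- too, and some secret needs m d advice bits on a sequence of m (1 + 3d) requests.

open import Data.Bool as Bool using (Bool; true; false; if_then_else_)
open import Data.Fin as Fin using (Fin; toℕ; fromℕ<; funToFin; finToFun; combine)
open import Data.Fin.Properties
  using (any?; injective⇒≤; 2↔Bool; toℕ-injective; toℕ-fromℕ<; finToFun-funToFin; funToFin-finToFin;
         combine-injective; combine-surjective)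
open import Data.Integer as ℤ using (_⊖_)
open import Data.Integer.Properties using (∣⊖∣-≤; ∣m⊖n∣≡∣n⊖m∣; m-n≡m⊖n; ∣i-j∣≡∣j-i∣; +-inverseʳ)
open import Data.List using (List; []; _∷_; _++_; [_]; length; map; zip; deduplicate; concatMap; allFin; filter)
open import Data.List.Properties
  using (map-cong-local; map-++; length-map; length-++; length-tabulate; length-removeAt′)
open import Data.List.Membership.Propositional using (_∈_; lose; find)
open import Data.List.Membership.Propositional.Properties
  using (∈-++⁻; ∈-++⁺ˡ; ∈-++⁺ʳ; ∈-∃++; ∈-map⁺; ∈-map⁻; ∈-concatMap⁺; ∈-concatMap⁻; ∈-allFin; ∈-filter⁺; ∈-filter⁻;
         ∈-deduplicate⁺; ∈-deduplicate⁻)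
open import Data.List.Relation.Unary.Any using (here; there; index; _─_)
open import Data.List.Relation.Unary.All as All using (All; []; _∷_)
import Data.List.Relation.Unary.All.Properties as All
open import Data.List.Relation.Unary.All.Properties using (all-upTo)
open import Data.List.Relation.Unary.AllPairs as AllPairs using (AllPairs; []; _∷_)
import Data.List.Relation.Unary.AllPairs.Properties as AllPairs
open import Data.List.Relation.Unary.Unique.Propositional using (Unique)
import Data.List.Relation.Unary.Unique.Propositional.Properties as Unique
open import Data.List.Relation.Unary.Unique.DecPropositional.Properties using (deduplicate-!)
open import Data.Nat using (ℕ; zero; suc; _≤_; _<_; _+_; _*_; _^_; _∸_; ∣_-_∣; z≤n; s≤s; s≤s⁻¹)
open import Data.Nat.Properties
  using (module ≤-Reasoning; _≟_; _≤?_; ≤-refl; ≤-reflexive; ≤-trans; ≤-total; <-cmp; ≰⇒>; <⇒≱; n≤1+n; n<1+n;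
         suc-injective; +-assoc; +-comm; +-suc; *-suc; +-monoˡ-≤; +-monoʳ-≤; *-monoʳ-≤; ∸-monoˡ-≤; ^-monoʳ-<;
         m≤m+n; m≤m*n; m+n∸m≡n; m≤n⇒∣m-n∣≡n∸m; m≤n⇒∣n-m∣≡n∸m; ∣m+n-m+o∣≡∣n-o∣; ∣-∣-comm)
open import Data.Nat.Tactic.RingSolver using (solve-∀)
open import Data.Product using (Σ; ∃; _×_; _,_; proj₁; proj₂)
open import Data.Sum using (inj₁; inj₂; [_,_]′)
open import Data.Unit using (⊤; tt)
open import Function using (_∘_; _on_; id)
open import Function.Bundles using (Inverse)
open import Relation.Binary.Definitions using (tri<; tri≈; tri>)
open import Relation.Binary.PropositionalEquality
  using (_≡_; _≢_; refl; sym; trans; cong; cong₂; subst; module ≡-Reasoning)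
open import Relation.Nullary using (¬_; does; yes; no; contradiction)
open import Relation.Nullary.Decidable using (dec-true; dec-false; decidable-stable)

open import Defs

module _ {A : Set} where

  ∈-─ : ∀ {x y : A} {xs} (x∈ : x ∈ xs) → y ∈ xs → y ≢ x → y ∈ (xs ─ x∈)
  ∈-─ (here refl) (here refl) y≢x = contradiction refl y≢x
  ∈-─ (here refl) (there y∈)  _   = y∈
  ∈-─ (there x∈)  (here refl) _   = here refl
  ∈-─ (there x∈)  (there y∈)  y≢x = there (∈-─ x∈ y∈ y≢x)

  Unique-⊆⇒length≤ : ∀ {xs ys : List A} → Unique xs → All (_∈ ys) xs → length xs ≤ length ys
  Unique-⊆⇒length≤ []                            []         = z≤n
  Unique-⊆⇒length≤ {x ∷ xs} {ys} (x∉xs ∷ unique) (x∈ ∷ xs⊆) = begin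
    suc (length xs)         ≤⟨ s≤s (Unique-⊆⇒length≤ unique xs⊆ys─x) ⟩
    suc (length (ys ─ x∈))  ≡⟨ sym (length-removeAt′ ys (index x∈)) ⟩
    length ys               ∎
    where
    open ≤-Reasoning
    xs⊆ys─x : All (_∈ (ys ─ x∈)) xs
    xs⊆ys─x = All.zipWith (λ (y∈ , x≢y) → ∈-─ x∈ y∈ (x≢y ∘ sym)) (xs⊆ , x∉xs)

  length-concatMap : ∀ {B : Set} (f : A → List B) {c} → (∀ x → length (f x) ≡ c) →
    ∀ xs → length (concatMap f xs) ≡ length xs * c
  length-concatMap f f-len []       = refl
  length-concatMap f f-len (x ∷ xs) =
    trans (length-++ (f x)) (cong₂ _+_ (f-len x) (length-concatMap f f-len xs))

module _ {A : Set} {R : A → A → Set} (R-sym : ∀ {x y} → R x y → R y x) where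

  AllPairs-split : ∀ ys {x} zs → AllPairs R (ys ++ x ∷ zs) → All (R x) (ys ++ zs) × AllPairs R (ys ++ zs)
  AllPairs-split []       zs (x-zs ∷ zs-pairs) = x-zs , zs-pairs
  AllPairs-split (y ∷ ys) zs (y-rest ∷ rest-pairs)
    with x-rest , pairs ← AllPairs-split ys zs rest-pairs
       | y-ys , y-x ∷ y-zs ← All.++⁻ ys y-rest
    = R-sym y-x ∷ x-rest , All.++⁺ y-ys y-zs ∷ pairs

module _ {A B : Set} where

  ∈-zip⁻ʳ : ∀ {x : A} {y : B} xs ys → (x , y) ∈ zip xs ys → y ∈ ys
  ∈-zip⁻ʳ (_ ∷ xs) (_ ∷ ys) (here refl) = here refl
  ∈-zip⁻ʳ (_ ∷ xs) (_ ∷ ys) (there x,y∈) = there (∈-zip⁻ʳ xs ys x,y∈)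

  ∈-zip⁺ : ∀ {x : A} xs (ys : List B) → x ∈ xs → length ys ≡ length xs → ∃ λ y → (x , y) ∈ zip xs ys
  ∈-zip⁺ (_ ∷ xs) (y ∷ ys) (here refl) _   = y , here refl
  ∈-zip⁺ (_ ∷ xs) (y ∷ ys) (there x∈) len≡ =
    let y′ , x,y′∈ = ∈-zip⁺ xs ys x∈ (suc-injective len≡) in y′ , there x,y′∈

  ∈-zip-++⁺ˡ : ∀ {p : A × B} xs ys xs′ ys′ → p ∈ zip xs ys → p ∈ zip (xs ++ xs′) (ys ++ ys′)
  ∈-zip-++⁺ˡ (_ ∷ xs) (_ ∷ ys) xs′ ys′ (here refl) = here refl
  ∈-zip-++⁺ˡ (_ ∷ xs) (_ ∷ ys) xs′ ys′ (there p∈)  = there (∈-zip-++⁺ˡ xs ys xs′ ys′ p∈)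

  ∈-zip-map⁻ : ∀ {C : Set} (f : C → A) (g : C → B) zs {p} →
    p ∈ zip (map f zs) (map g zs) → ∃ λ z → z ∈ zs × p ≡ (f z , g z)
  ∈-zip-map⁻ f g (z ∷ zs) (here refl) = z , here refl , refl
  ∈-zip-map⁻ f g (z ∷ zs) (there p∈)  =
    let z′ , z′∈ , p≡ = ∈-zip-map⁻ f g zs p∈ in z′ , there z′∈ , p≡

funToFin-cong : ∀ {m n} {f g : Fin m → Fin n} → (∀ i → f i ≡ g i) → funToFin f ≡ funToFin g
funToFin-cong {zero}  f≗g = refl
funToFin-cong {suc m} f≗g = cong₂ combine (f≗g Fin.zero) (funToFin-cong (f≗g ∘ Fin.suc))

finToFun-injective : ∀ {m n} {s s′ : Fin (n ^ m)} → (∀ i → finToFun {n} {m} s i ≡ finToFun s′ i) → s ≡ s′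
finToFun-injective {m} {n} {s} {s′} s≗s′ =
  trans (sym (funToFin-finToFin {m} {n} s)) (trans (funToFin-cong {m} {n} s≗s′) (funToFin-finToFin {m} {n} s′))

-- Runs of online algorithms with advice

AgreeBelow : ℕ → Tape → Tape → Set
AgreeBelow k φ φ′ = ∀ p → p < k → φ p ≡ φ′ p

prefix-cong : ∀ {φ φ′} k → AgreeBelow k φ φ′ → prefix φ k ≡ prefix φ′ k
prefix-cong k agree = map-cong-local (All.map (agree _) (all-upTo k))

exec-advances : ∀ s φ pos → pos ≤ proj₂ (exec s φ pos)
exec-advances (decide ℓ)  φ pos = ≤-refl
exec-advances (readBit f) φ pos = ≤-trans (n≤1+n pos) (exec-advances (f (φ pos)) φ (suc pos))

exec-cong : ∀ s φ φ′ pos → AgreeBelow (proj₂ (exec s φ pos)) φ φ′ → exec s φ′ pos ≡ exec s φ pos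
exec-cong (decide ℓ)  φ φ′ pos agree = refl
exec-cong (readBit f) φ φ′ pos agree
  rewrite sym (agree pos (exec-advances (f (φ pos)) φ (suc pos))) = exec-cong (f (φ pos)) φ φ′ (suc pos) agree

module _ {d : ℕ} (A : OnlineAlg d) where

  runFrom-advances : ∀ φ hist pos xs → pos ≤ proj₂ (runFrom A φ hist pos xs)
  runFrom-advances φ hist pos []       = ≤-refl
  runFrom-advances φ hist pos (x ∷ xs) =
    ≤-trans (exec-advances (A hist (prefix φ pos) x) φ pos) (runFrom-advances φ (hist ++ [ x ]) _ xs)

  length-runFrom : ∀ φ hist pos xs → length (proj₁ (runFrom A φ hist pos xs)) ≡ length xs
  length-runFrom φ hist pos []       = refl
  length-runFrom φ hist pos (x ∷ xs) = cong suc (length-runFrom φ (hist ++ [ x ]) _ xs)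

  runFrom-++ : ∀ φ hist pos xs ys → Σ (List ℕ) λ rest →
    proj₁ (runFrom A φ hist pos (xs ++ ys)) ≡ proj₁ (runFrom A φ hist pos xs) ++ rest ×
    proj₂ (runFrom A φ hist pos xs) ≤ proj₂ (runFrom A φ hist pos (xs ++ ys))
  runFrom-++ φ hist pos []       ys = proj₁ (runFrom A φ hist pos ys) , refl , runFrom-advances φ hist pos ys
  runFrom-++ φ hist pos (x ∷ xs) ys
    with rest , labels≡ , read≤ ← runFrom-++ φ (hist ++ [ x ]) (proj₂ (exec (A hist (prefix φ pos) x) φ pos)) xs ys
    = rest , cong (_ ∷_) labels≡ , read≤

  runFrom-cong : ∀ φ φ′ hist pos xs → AgreeBelow (proj₂ (runFrom A φ hist pos xs)) φ φ′ →
    runFrom A φ′ hist pos xs ≡ runFrom A φ hist pos xs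
  runFrom-cong φ φ′ hist pos []       agree = refl
  runFrom-cong φ φ′ hist pos (x ∷ xs) agree
    rewrite sym (prefix-cong pos (λ p p< → agree p (≤-trans p< (runFrom-advances φ hist pos (x ∷ xs)))))
          | exec-cong (A hist (prefix φ pos) x) φ φ′ pos
              (λ p p< → agree p (≤-trans p< (runFrom-advances φ (hist ++ [ x ]) _ xs)))
          | runFrom-cong φ φ′ (hist ++ [ x ]) (proj₂ (exec (A hist (prefix φ pos) x) φ pos)) xs agree
    = refl

-- Otherwise the first k tape bits would determine the input: an injection Fin (2 ^ suc k) → Fin (2 ^ k).
advice-pigeonhole : ∀ K (tape : Fin (2 ^ K) → Tape) (read : Fin (2 ^ K) → ℕ) →
  (∀ s s′ → AgreeBelow (read s) (tape s) (tape s′) → s ≡ s′) → ∃ λ s → K ≤ read s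
advice-pigeonhole zero    tape read determined = Fin.zero , z≤n
advice-pigeonhole (suc k) tape read determined with any? (λ s → suc k ≤? read s)
... | yes long = long
... | no  none = contradiction (injective⇒≤ code-injective) (<⇒≱ (^-monoʳ-< 2 (s≤s (s≤s z≤n)) (n<1+n k)))
  where
  open Inverse 2↔Bool using (to; from; strictlyInverseˡ)
  open ≡-Reasoning

  code : Fin (2 ^ suc k) → Fin (2 ^ k)
  code s = funToFin {k} (λ i → from (tape s (toℕ i)))

  decode-code : ∀ s i → to (finToFun (code s) i) ≡ tape s (toℕ i)
  decode-code s i = trans (cong to (finToFun-funToFin {k} (λ i → from (tape s (toℕ i))) i)) (strictlyInverseˡ _)

  code-injective : ∀ {s s′} → code s ≡ code s′ → s ≡ s′
  code-injective {s} {s′} code≡ = determined s s′ λ p p<read →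
    let i = fromℕ< (≤-trans p<read (s≤s⁻¹ (≰⇒> (none ∘ (s ,_))))) in
    begin
      tape s p                  ≡⟨ cong (tape s) (sym (toℕ-fromℕ< _)) ⟩
      tape s (toℕ i)            ≡⟨ sym (decode-code s i) ⟩
      to (finToFun (code s) i)  ≡⟨ cong (λ c → to (finToFun c i)) code≡ ⟩
      to (finToFun (code s′) i) ≡⟨ decode-code s′ i ⟩
      tape s′ (toℕ i)           ≡⟨ cong (tape s′) (toℕ-fromℕ< _) ⟩
      tape s′ p                 ∎

-- Lower bounds on the cost of a clustering

Far : ∀ {d} → Point d → Point d → Set
Far p q = ¬ Close p q

cost≤length : ∀ {ls ys} → All (_∈ ys) ls → cost ls ≤ length ys
cost≤length {ls} ls⊆ys =
  Unique-⊆⇒length≤ (deduplicate-! _≟_ ls) (All.tabulate (All.lookup ls⊆ys ∘ ∈-deduplicate⁻ _≟_ ls))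

module Occurrences {d : ℕ} (σ : List (Point d)) (ls : List ℕ) where

  record Occurrence : Set where
    constructor occurrence
    field
      point  : Point d
      label  : ℕ
      occurs : (point , label) ∈ zip σ ls

  open Occurrence public

  occurrences : length ls ≡ length σ → ∀ xs → All (_∈ σ) xs → Σ (List Occurrence) λ os → map point os ≡ xs
  occurrences len≡ []       []          = [] , refl
  occurrences len≡ (x ∷ xs) (x∈ ∷ xs⊆σ) =
    let a , x,a∈     = ∈-zip⁺ σ ls x∈ len≡
        os , points≡ = occurrences len≡ xs xs⊆σ
    in occurrence x a x,a∈ ∷ os , cong (x ∷_) points≡

  distinct-labels≤cost : (os : List Occurrence) → AllPairs (_≢_ on label) os → length os ≤ cost ls
  distinct-labels≤cost os distinct = begin
    length os              ≡⟨ sym (length-map label os) ⟩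
    length (map label os)  ≤⟨ Unique-⊆⇒length≤ (AllPairs.map⁺ distinct) labels⊆ ⟩
    cost ls                ∎
    where
    open ≤-Reasoning
    labels⊆ : All (_∈ deduplicate _≟_ ls) (map label os)
    labels⊆ = All.map⁺ (All.tabulate (λ {o} _ → ∈-deduplicate⁺ _≟_ (∈-zip⁻ʳ σ ls (occurs o))))

  module _ (valid : ValidClustering σ ls) where

    far⇒distinct-labels : ∀ {o o′} → Far (point o) (point o′) → label o ≢ label o′
    far⇒distinct-labels {o} {o′} far labels≡ = far (proj₂ valid (occurs o) (occurs o′) labels≡)

    distinct+far≤cost : (os : List Occurrence) (xs : List (Point d)) →
      AllPairs (_≢_ on label) os → All (_∈ σ) xs → AllPairs Far xs → All (λ o → All (Far (point o)) xs) os →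
      length os + length xs ≤ cost ls
    distinct+far≤cost os xs os-distinct xs⊆σ xs-far os-far = begin
      length os + length xs  ≡⟨ cong (length os +_) (trans (cong length (sym points≡)) (length-map point ys)) ⟩
      length os + length ys  ≡⟨ sym (length-++ os) ⟩
      length (os ++ ys)      ≤⟨ distinct-labels≤cost (os ++ ys) (AllPairs.++⁺ os-distinct ys-distinct os-ys-distinct) ⟩
      cost ls                ∎
      where
      open ≤-Reasoning
      ys : List Occurrence
      ys = proj₁ (occurrences (proj₁ valid) xs xs⊆σ)
      points≡ : map point ys ≡ xs
      points≡ = proj₂ (occurrences (proj₁ valid) xs xs⊆σ)
      ys-distinct : AllPairs (_≢_ on label) ys
      ys-distinct = AllPairs.map (λ {o} {o′} → far⇒distinct-labels {o} {o′})
                                 (AllPairs.map⁻ (subst (AllPairs Far) (sym points≡) xs-far))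
      os-ys-distinct : All (λ o → All (λ o′ → label o ≢ label o′) ys) os
      os-ys-distinct = All.map (λ {o} o-far → All.map (λ {o′} → far⇒distinct-labels {o} {o′})
                                                       (All.map⁻ (subst (All _) (sym points≡) o-far))) os-far

∣+m-+n∣≡∣m-n∣ : ∀ m n → ℤ.∣ ℤ.+ m ℤ.- ℤ.+ n ∣ ≡ ∣ m - n ∣
∣+m-+n∣≡∣m-n∣ m n rewrite m-n≡m⊖n m n with ≤-total m n
... | inj₁ m≤n = begin
  ℤ.∣ m ⊖ n ∣  ≡⟨ ∣⊖∣-≤ m≤n ⟩
  n ∸ m        ≡⟨ sym (m≤n⇒∣m-n∣≡n∸m m≤n) ⟩
  ∣ m - n ∣    ∎
  where open ≡-Reasoning
... | inj₂ n≤m = begin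
  ℤ.∣ m ⊖ n ∣  ≡⟨ ∣m⊖n∣≡∣n⊖m∣ m n ⟩
  ℤ.∣ n ⊖ m ∣  ≡⟨ ∣⊖∣-≤ n≤m ⟩
  m ∸ n        ≡⟨ sym (m≤n⇒∣n-m∣≡n∸m n≤m) ⟩
  ∣ m - n ∣    ∎
  where open ≡-Reasoning

+2≤⇒2≤∣-∣ : ∀ {m n} → m + 2 ≤ n → 2 ≤ ∣ m - n ∣
+2≤⇒2≤∣-∣ {m} {n} m+2≤n = begin
  2          ≡⟨ sym (m+n∸m≡n m 2) ⟩
  m + 2 ∸ m  ≤⟨ ∸-monoˡ-≤ m m+2≤n ⟩
  n ∸ m      ≡⟨ sym (m≤n⇒∣m-n∣≡n∸m (≤-trans (m≤m+n m 2) m+2≤n)) ⟩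
  ∣ m - n ∣  ∎
  where open ≤-Reasoning

∣-∣≤1-in-unit-interval : ∀ c {m n} → c ≤ m → m ≤ suc c → c ≤ n → n ≤ suc c → ∣ m - n ∣ ≤ 1
∣-∣≤1-in-unit-interval zero _ z≤n       _ z≤n       = z≤n
∣-∣≤1-in-unit-interval zero _ z≤n       _ (s≤s z≤n) = ≤-refl
∣-∣≤1-in-unit-interval zero _ (s≤s z≤n) _ z≤n       = ≤-refl
∣-∣≤1-in-unit-interval zero _ (s≤s z≤n) _ (s≤s z≤n) = z≤n
∣-∣≤1-in-unit-interval (suc c) (s≤s c≤m) (s≤s m≤c+1) (s≤s c≤n) (s≤s n≤c+1) =
  ∣-∣≤1-in-unit-interval c c≤m m≤c+1 c≤n n≤c+1

module _ {d : ℕ} where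

  close-refl : {p : Point d} → Close p p
  close-refl {p} j = subst (_≤ 1) (sym (cong ℤ.∣_∣ (+-inverseʳ (p j)))) z≤n

  close-sym : {p q : Point d} → Close p q → Close q p
  close-sym {p} {q} close j = subst (_≤ 1) (∣i-j∣≡∣j-i∣ (p j) (q j)) (close j)

  far-sym : {p q : Point d} → Far p q → Far q p
  far-sym {p} {q} far = far ∘ close-sym {q} {p}

  far-at : {p q : Point d} → ∀ j → 2 ≤ ℤ.∣ p j ℤ.- q j ∣ → Far p q
  far-at j 2≤ close = <⇒≱ 2≤ (close j)

-- Gadgets

module Gadget (d : ℕ) where

  data Piece : Set where
    centre        : Piece
    up down spike : Fin d → Piece

  axial : Fin d → ℕ → Fin d → ℕ
  axial i v j = if does (j Fin.≟ i) then v else 1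

  axial-at : ∀ i v → axial i v i ≡ v
  axial-at i v rewrite dec-true (i Fin.≟ i) refl = refl

  axial-off : ∀ {i j} v → j ≢ i → axial i v j ≡ 1
  axial-off {i} {j} v j≢i rewrite dec-false (j Fin.≟ i) j≢i = refl

  axial≤ : ∀ i {v} j → v ≤ 3 → axial i v j ≤ 3
  axial≤ i j v≤3 with does (j Fin.≟ i)
  ... | true  = v≤3
  ... | false = s≤s z≤n

  axial-0≤1 : ∀ i j → axial i 0 j ≤ 1
  axial-0≤1 i j with does (j Fin.≟ i)
  ... | true  = z≤n
  ... | false = ≤-refl

  offset : Piece → Fin d → ℕ
  offset centre    _ = 1
  offset (up i)      = axial i 2
  offset (down i)    = axial i 0
  offset (spike i)   = axial i 3

  offset≤3 : ∀ x j → offset x j ≤ 3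
  offset≤3 centre    j = s≤s z≤n
  offset≤3 (up i)    j = axial≤ i j (s≤s (s≤s z≤n))
  offset≤3 (down i)  j = axial≤ i j z≤n
  offset≤3 (spike i) j = axial≤ i j ≤-refl

  site : ℕ → Piece → Point d
  site g x j = ℤ.+ (5 * g + offset x j)

  ∣site-site∣ : ∀ g x y j → ℤ.∣ site g x j ℤ.- site g y j ∣ ≡ ∣ offset x j - offset y j ∣
  ∣site-site∣ g x y j =
    trans (∣+m-+n∣≡∣m-n∣ (5 * g + offset x j) (5 * g + offset y j)) (∣m+n-m+o∣≡∣n-o∣ (5 * g) (offset x j) (offset y j))

  close-offsets⇒close : ∀ g {x y} → (∀ j → ∣ offset x j - offset y j ∣ ≤ 1) → Close (site g x) (site g y)
  close-offsets⇒close g {x} {y} close j = subst (_≤ 1) (sym (∣site-site∣ g x y j)) (close j)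

  far-offsets⇒far : ∀ g x y j → 2 ≤ ∣ offset x j - offset y j ∣ → Far (site g x) (site g y)
  far-offsets⇒far g x y j 2≤ = far-at {p = site g x} {q = site g y} j (subst (2 ≤_) (sym (∣site-site∣ g x y j)) 2≤)

  far-spike : ∀ g k {x} → offset x k ≤ 1 → Far (site g (spike k)) (site g x)
  far-spike g k {x} xₖ≤1 = far-offsets⇒far g (spike k) x k (begin
    2                                    ≤⟨ +2≤⇒2≤∣-∣ (+-monoˡ-≤ 2 xₖ≤1) ⟩
    ∣ offset x k - 3 ∣                   ≡⟨ ∣-∣-comm (offset x k) 3 ⟩
    ∣ 3 - offset x k ∣                   ≡⟨ cong (∣_- offset x k ∣) (sym (axial-at k 3)) ⟩
    ∣ offset (spike k) k - offset x k ∣  ∎)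
    where open ≤-Reasoning

  far-up-down : ∀ g i → Far (site g (up i)) (site g (down i))
  far-up-down g i =
    far-offsets⇒far g (up i) (down i) i (subst (2 ≤_) (sym (cong₂ ∣_-_∣ (axial-at i 2) (axial-at i 0))) ≤-refl)

  far-gadgets-< : ∀ {g h} x y → Fin d → g < h → Far (site g x) (site h y)
  far-gadgets-< {g} {h} x y j g<h =
    far-at {p = site g x} {q = site h y} j
      (subst (2 ≤_) (sym (∣+m-+n∣≡∣m-n∣ (5 * g + offset x j) (5 * h + offset y j))) (+2≤⇒2≤∣-∣ (begin
        5 * g + offset x j + 2  ≤⟨ +-monoˡ-≤ 2 (+-monoʳ-≤ (5 * g) (offset≤3 x j)) ⟩
        5 * g + 3 + 2           ≡⟨ trans (+-assoc (5 * g) 3 2) (+-comm (5 * g) 5) ⟩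
        5 + 5 * g               ≡⟨ sym (*-suc 5 g) ⟩
        5 * suc g               ≤⟨ *-monoʳ-≤ 5 g<h ⟩
        5 * h                   ≤⟨ m≤m+n (5 * h) (offset y j) ⟩
        5 * h + offset y j      ∎)))
    where open ≤-Reasoning

  far-gadgets : ∀ {g h} x y → Fin d → g ≢ h → Far (site g x) (site h y)
  far-gadgets {g} {h} x y j g≢h with <-cmp g h
  ... | tri< g<h _ _ = far-gadgets-< x y j g<h
  ... | tri≈ _ g≡h _ = contradiction g≡h g≢h
  ... | tri> _ _ h<g = far-sym {p = site h y} {q = site g x} (far-gadgets-< y x j h<g)

  Bits : Set
  Bits = Fin d → Bool

  Admissible : Bits → Piece → Set
  Admissible b (down i)  = b i ≡ false
  Admissible b (spike i) = b i ≡ false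
  Admissible b _         = ⊤

  -- The clusters of an optimal clustering of one gadget: cell zero is the unit cube
  -- holding the centre, every up i with bit 1 and every down i; cell (suc i) is the
  -- cube holding up i and spike i for a zero bit i.
  cell : Bits → Piece → Fin (suc d)
  cell b centre    = Fin.zero
  cell b (up i)    = if b i then Fin.zero else Fin.suc i
  cell b (down i)  = Fin.zero
  cell b (spike i) = Fin.suc i

  corner : Bits → Fin (suc d) → Fin d → ℕ
  corner b Fin.zero    j = if b j then 1 else 0
  corner b (Fin.suc i)   = offset (up i)

  InCube : (Fin d → ℕ) → (Fin d → ℕ) → Set
  InCube c o = ∀ j → c j ≤ o j × o j ≤ suc (c j)

  cube-close : ∀ {c} g x y → InCube c (offset x) → InCube c (offset y) → Close (site g x) (site g y)
  cube-close {c} g x y x∈ y∈ = close-offsets⇒close g {x} {y} λ j →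
    ∣-∣≤1-in-unit-interval (c j) (proj₁ (x∈ j)) (proj₂ (x∈ j)) (proj₁ (y∈ j)) (proj₂ (y∈ j))

  one-in-cube-zero : ∀ b j → corner b Fin.zero j ≤ 1 × 1 ≤ suc (corner b Fin.zero j)
  one-in-cube-zero b j with b j
  ... | true  = ≤-refl , s≤s z≤n
  ... | false = z≤n , ≤-refl

  in-cell : ∀ b x → Admissible b x → InCube (corner b (cell b x)) (offset x)
  in-cell b centre    _ j = one-in-cube-zero b j
  in-cell b (up i)    _ j with b i in bᵢ≡
  ... | false = ≤-refl , n≤1+n _
  ... | true with j Fin.≟ i
  ...   | yes refl rewrite bᵢ≡ = s≤s z≤n , ≤-refl
  ...   | no _     = one-in-cube-zero b j
  in-cell b (down i)  bᵢ≡false j with j Fin.≟ i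
  ... | yes refl rewrite bᵢ≡false = z≤n , z≤n
  ... | no _     = one-in-cube-zero b j
  in-cell b (spike i) _ j with j Fin.≟ i
  ... | yes refl = s≤s (s≤s z≤n) , ≤-refl
  ... | no _     = ≤-refl , s≤s z≤n

-- The request sequences

module Requests {d : ℕ} (m : ℕ) where
  open Gadget d

  Node : Set
  Node = Fin m × Piece

  point : Node → Point d
  point (g , x) = site (toℕ g) x

  gadgets : (Fin m → List Piece) → List Node
  gadgets f = concatMap (λ g → map (g ,_) (f g)) (allFin m)

  ∈-gadgets⁺ : ∀ f {g x} → x ∈ f g → (g , x) ∈ gadgets f
  ∈-gadgets⁺ f {g} x∈ = ∈-concatMap⁺ (λ h → map (h ,_) (f h)) (lose (∈-allFin g) (∈-map⁺ (g ,_) x∈))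

  ∈-gadgets⁻ : ∀ f {g x} → (g , x) ∈ gadgets f → x ∈ f g
  ∈-gadgets⁻ f n∈
    with _ , _ , n∈g ← find (∈-concatMap⁻ (λ h → map (h ,_) (f h)) {xs = allFin m} n∈)
    with _ , x∈ , refl ← ∈-map⁻ _ n∈g
    = x∈

  length-gadgets : ∀ f {c} → (∀ g → length (f g) ≡ c) → length (gadgets f) ≡ m * c
  length-gadgets f {c} f-len =
    trans (length-concatMap _ (λ g → trans (length-map (g ,_) (f g)) (f-len g)) (allFin m))
          (cong (_* c) (length-tabulate {n = m} id))

  -- A bit 1 repeats up i, so that all request sequences have the same length.
  probe : Bool → Fin d → List Piece
  probe true  i = up i ∷ up i ∷ []
  probe false i = down i ∷ spike i ∷ []

  zeros : Bits → List (Fin d)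
  zeros b = filter (λ i → b i Bool.≟ false) (allFin d)

  witness-pieces : Bits → List Piece
  witness-pieces b = centre ∷ map spike (zeros b)

  spike∈witness-pieces : ∀ {b i} → b i ≡ false → spike i ∈ witness-pieces b
  spike∈witness-pieces {b} {i} bᵢ≡false =
    there (∈-map⁺ spike (∈-filter⁺ (λ i → b i Bool.≟ false) (∈-allFin i) bᵢ≡false))

  cell-witnessed : ∀ b x → Admissible b x → ∃ λ y → y ∈ witness-pieces b × cell b y ≡ cell b x
  cell-witnessed b centre    _        = centre , here refl , refl
  cell-witnessed b (down i)  _        = centre , here refl , refl
  cell-witnessed b (spike i) bᵢ≡false = spike i , spike∈witness-pieces bᵢ≡false , refl
  cell-witnessed b (up i)    _ with b i in bᵢ≡
  ... | true  = centre , here refl , refl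
  ... | false = spike i , spike∈witness-pieces bᵢ≡ , refl

  witness-pieces-far : ∀ g b → AllPairs (Far on site g) (witness-pieces b)
  witness-pieces-far g b =
    All.map⁺ (All.universal (λ k → far-sym {p = site g (spike k)} {q = site g centre} (far-spike g k {centre} ≤-refl)) _)
    ∷ AllPairs.map⁺ (AllPairs.map (λ {k} {k′} k≢k′ → far-spike g k {spike k′} (≤-reflexive (axial-off 3 k≢k′)))
                                  (Unique.filter⁺ _ (Unique.allFin⁺ d)))

  phase₁ : List Node
  phase₁ = gadgets (λ _ → centre ∷ map up (allFin d))

  module _ (bits : Fin m → Bits) where

    phase₂ : List Node
    phase₂ = gadgets (λ g → concatMap (λ i → probe (bits g i) i) (allFin d))

    nodes : List Node
    nodes = phase₁ ++ phase₂

    requests : List (Point d)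
    requests = map point nodes

    witnesses : List Node
    witnesses = gadgets (witness-pieces ∘ bits)

    label* : Node → ℕ
    label* (g , x) = toℕ (combine g (cell (bits g) x))

    labels* : List ℕ
    labels* = map label* nodes

    length-requests : length requests ≡ m * suc d + m * (d * 2)
    length-requests = begin
      length (map point nodes)       ≡⟨ length-map point nodes ⟩
      length (phase₁ ++ phase₂)      ≡⟨ length-++ phase₁ ⟩
      length phase₁ + length phase₂  ≡⟨ cong₂ _+_ (length-gadgets _ λ _ → cong suc (length-map up (allFin d)))
                                                   (length-gadgets _ λ g → length-concatMap _ (length-probe g) (allFin d)) ⟩
      m * suc (length (allFin d)) + m * (length (allFin d) * 2)
                                     ≡⟨ cong (λ n → m * suc n + m * (n * 2)) (length-tabulate id) ⟩
      m * suc d + m * (d * 2)        ∎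
      where
      open ≡-Reasoning
      length-probe : ∀ g i → length (probe (bits g i) i) ≡ 2
      length-probe g i with bits g i
      ... | true  = refl
      ... | false = refl

    nodes-admissible : ∀ {g x} → (g , x) ∈ nodes → Admissible (bits g) x
    nodes-admissible n∈ with ∈-++⁻ phase₁ n∈
    ... | inj₁ n∈₁ with ∈-gadgets⁻ _ n∈₁
    ...   | here refl = tt
    ...   | there up∈ with _ , _ , refl ← ∈-map⁻ up up∈ = tt
    nodes-admissible {g} n∈ | inj₂ n∈₂
      with i , _ , x∈ ← find (∈-concatMap⁻ (λ i → probe (bits g i) i) {xs = allFin d} (∈-gadgets⁻ _ n∈₂))
      with bits g i in bᵢ≡ | x∈
    ... | true  | here refl         = tt
    ... | true  | there (here refl) = tt
    ... | false | here refl         = bᵢ≡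
    ... | false | there (here refl) = bᵢ≡

    valid* : ValidClustering requests labels*
    valid* = trans (length-map label* nodes) (sym (length-map point nodes)) , same-label⇒close
      where
      same-label⇒close : ∀ {p q a b} → (p , a) ∈ zip requests labels* → (q , b) ∈ zip requests labels* →
        a ≡ b → Close p q
      same-label⇒close p∈ q∈ a≡b
        with (g , x) , n∈ , refl ← ∈-zip-map⁻ point label* nodes p∈
           | (h , y) , n′∈ , refl ← ∈-zip-map⁻ point label* nodes q∈
        with refl , cell≡ ← combine-injective g _ h _ (toℕ-injective a≡b)
        = cube-close (toℕ g) x y (in-cell (bits g) x (nodes-admissible n∈))
            (subst (λ c → InCube (corner (bits g) c) (offset y)) (sym cell≡) (in-cell (bits g) y (nodes-admissible n′∈)))

    labels*⊆witness-labels : All (_∈ map label* witnesses) labels*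
    labels*⊆witness-labels = All.map⁺ (All.tabulate witnessed)
      where
      witnessed : ∀ {n} → n ∈ nodes → label* n ∈ map label* witnesses
      witnessed {g , x} n∈ with y , y∈ , cell≡ ← cell-witnessed (bits g) x (nodes-admissible n∈) =
        subst (_∈ map label* witnesses) (cong (toℕ ∘ combine g) cell≡) (∈-map⁺ label* (∈-gadgets⁺ _ y∈))

    cost*≤witnesses : cost labels* ≤ length witnesses
    cost*≤witnesses = ≤-trans (cost≤length labels*⊆witness-labels) (≤-reflexive (length-map label* witnesses))

    probe⊆requests : ∀ {g i x} → x ∈ probe (bits g i) i → point (g , x) ∈ requests
    probe⊆requests {g} {i} x∈ =
      ∈-map⁺ point (∈-++⁺ʳ phase₁ (∈-gadgets⁺ _ {g} (∈-concatMap⁺ (λ i → probe (bits g i) i) (lose (∈-allFin i) x∈))))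

    witnesses⊆requests : ∀ {n} → n ∈ witnesses → point n ∈ requests
    witnesses⊆requests {g , x} n∈ with ∈-gadgets⁻ _ n∈
    ... | here refl = ∈-map⁺ point (∈-++⁺ˡ (∈-gadgets⁺ _ {g} (here refl)))
    ... | there spike∈
      with i , i∈ , refl ← ∈-map⁻ spike spike∈
      with _ , bᵢ≡false ← ∈-filter⁻ _ {xs = allFin d} i∈
      = probe⊆requests (subst (λ b → spike i ∈ probe b i) (sym bᵢ≡false) (there (here refl)))

    module _ (axis : Fin d) where

      witnesses-far : AllPairs (Far on point) witnesses
      witnesses-far = AllPairs.concat⁺ (All.map⁺ (All.universal within _))
                                       (AllPairs.map⁺ (AllPairs.map across (Unique.allFin⁺ m)))
        where
        within : ∀ g → AllPairs (Far on point) (map (g ,_) (witness-pieces (bits g)))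
        within g = AllPairs.map⁺ (witness-pieces-far (toℕ g) (bits g))
        across : ∀ {g h} → g ≢ h →
          All (λ u → All ((Far on point) u) (map (h ,_) (witness-pieces (bits h)))) (map (g ,_) (witness-pieces (bits g)))
        across {g} {h} g≢h = All.map⁺ (All.universal (λ x → All.map⁺ (All.universal (λ y →
          far-gadgets {toℕ g} {toℕ h} x y axis (g≢h ∘ toℕ-injective)) _)) _)

      witnesses-but-centre : ∀ g → Σ (List Node) λ rest →
        length witnesses ≡ suc (length rest) × (∀ {n} → n ∈ rest → n ∈ witnesses) ×
        All (Far (point (g , centre)) ∘ point) rest × AllPairs (Far on point) rest
      witnesses-but-centre g
        with ys , zs , witnesses≡ ← ∈-∃++ (∈-gadgets⁺ (witness-pieces ∘ bits) {g} (here refl))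
        with centre-far , rest-far ← AllPairs-split (λ {u} {v} → far-sym {p = point u} {q = point v}) ys zs
                                       (subst (AllPairs (Far on point)) witnesses≡ witnesses-far)
        = ys ++ zs , length≡ , rest⊆ , centre-far , rest-far
        where
        open ≡-Reasoning
        length≡ : length witnesses ≡ suc (length (ys ++ zs))
        length≡ = begin
          length witnesses                  ≡⟨ cong length witnesses≡ ⟩
          length (ys ++ (g , centre) ∷ zs)  ≡⟨ length-++ ys ⟩
          length ys + suc (length zs)       ≡⟨ +-suc (length ys) (length zs) ⟩
          suc (length ys + length zs)       ≡⟨ cong suc (sym (length-++ ys)) ⟩
          suc (length (ys ++ zs))           ∎
        rest⊆ : ∀ {n} → n ∈ ys ++ zs → n ∈ witnesses
        rest⊆ n∈ = subst (_ ∈_) (sym witnesses≡) ([ ∈-++⁺ˡ , ∈-++⁺ʳ ys ∘ there ]′ (∈-++⁻ ys n∈))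

      far-from-witnesses : ∀ g x → (∀ k → bits g k ≡ false → offset x k ≤ 1) →
        ∀ {n} → n ∈ witnesses → Far (point (g , centre)) (point n) → Far (point (g , x)) (point n)
      far-from-witnesses g x low {h , y} n∈ centre-far with h Fin.≟ g | ∈-gadgets⁻ _ n∈
      ... | no h≢g   | _         = far-gadgets {toℕ g} {toℕ h} x y axis (h≢g ∘ sym ∘ toℕ-injective)
      ... | yes refl | here refl = contradiction (close-refl {p = point (g , centre)}) centre-far
      ... | yes refl | there spike∈ with k , k∈ , refl ← ∈-map⁻ spike spike∈ =
        far-sym {p = point (g , spike k)} {q = point (g , x)}
                (far-spike (toℕ g) k {x} (low k (proj₂ (∈-filter⁻ _ {xs = allFin d} k∈))))

      module OptimalClustering (ls : List ℕ) (optimal : Optimal requests ls) where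
        open Occurrences requests ls using (occurrence; distinct+far≤cost; far⇒distinct-labels)

        -- Otherwise the centre of g (label a), x (label b) and the other witnesses carry
        -- pairwise distinct labels: one more cluster than labels* uses.
        centre-shares-label : ∀ g x {a b} → (∀ k → bits g k ≡ false → offset x k ≤ 1) →
          (point (g , centre) , a) ∈ zip requests ls → (point (g , x) , b) ∈ zip requests ls → ¬ a ≢ b
        centre-shares-label g x low c∈ x∈ a≢b
          with rest , length≡ , rest⊆ , centre-far , rest-far ← witnesses-but-centre g
          = <⇒≱ (begin-strict
            length witnesses             ≡⟨ length≡ ⟩
            suc (length rest)            <⟨ ≤-refl ⟩
            2 + length rest              ≡⟨ cong (2 +_) (sym (length-map point rest)) ⟩
            2 + length (map point rest)  ≤⟨ distinct+far≤cost (proj₁ optimal)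
                                              (occurrence _ _ c∈ ∷ occurrence _ _ x∈ ∷ []) (map point rest)
                                              ((a≢b ∷ []) ∷ [] ∷ [])
                                              (All.map⁺ (All.tabulate (witnesses⊆requests ∘ rest⊆)))
                                              (AllPairs.map⁺ rest-far)
                                              (All.map⁺ centre-far ∷ All.map⁺ x-far ∷ []) ⟩
            cost ls                      ∎)
            (≤-trans (proj₂ optimal labels* valid*) cost*≤witnesses)
          where
          open ≤-Reasoning
          x-far : All (Far (point (g , x)) ∘ point) rest
          x-far = All.tabulate (λ n∈ → far-from-witnesses g x low (rest⊆ n∈) (All.lookup centre-far n∈))

        bit-read-off : ∀ g i {a b} → (point (g , centre) , a) ∈ zip requests ls → (point (g , up i) , b) ∈ zip requests ls →
          bits g i ≡ does (a ≟ b)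
        bit-read-off g i {a} {b} c∈ up∈ with bits g i in bᵢ≡
        ... | true  = sym (dec-true (a ≟ b) (decidable-stable (a ≟ b) (centre-shares-label g (up i) up-low c∈ up∈)))
          where
          up-low : ∀ k → bits g k ≡ false → offset (up i) k ≤ 1
          up-low k bₖ≡false = ≤-reflexive (axial-off {i} {k} 2 λ { refl → contradiction (trans (sym bₖ≡false) bᵢ≡) λ () })
        ... | false = sym (dec-false (a ≟ b) λ a≡b →
                        centre-shares-label g (down i) (λ k _ → axial-0≤1 i k) c∈ (proj₂ down-occurs) (up≢down ∘ trans (sym a≡b)))
          where
          down-occurs : ∃ λ c → (point (g , down i) , c) ∈ zip requests ls
          down-occurs = ∈-zip⁺ requests ls (probe⊆requests (subst (λ b → down i ∈ probe b i) (sym bᵢ≡) (here refl)))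
                               (proj₁ (proj₁ optimal))
          up≢down : b ≢ proj₁ down-occurs
          up≢down = far⇒distinct-labels (proj₁ optimal) {occurrence _ _ up∈} {occurrence _ _ (proj₂ down-occurs)}
                                        (far-up-down (toℕ g) i)

module LowerBound {d : ℕ} (axis : Fin d) (A : OnlineAlg d) (oracle : List (Point d) → Tape)
                  (optimal : ∀ σ → Optimal σ (proj₁ (run A (oracle σ) σ))) (m : ℕ) where
  open Gadget d
  open Requests {d} m

  K : ℕ
  K = m * d

  Input : Set
  Input = Fin (2 ^ K)

  bits : Input → Fin m → Bits
  bits s g i = Inverse.to 2↔Bool (finToFun s (combine g i))

  bits-injective : ∀ {s s′} → (∀ g i → bits s g i ≡ bits s′ g i) → s ≡ s′
  bits-injective {s} {s′} bits≡ = finToFun-injective λ k →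
    let g , i , k≡ = combine-surjective {m} {d} k
    in subst (λ k → finToFun s k ≡ finToFun s′ k) k≡ (begin
      finToFun s (combine g i)               ≡⟨ sym (strictlyInverseʳ _) ⟩
      from (to (finToFun s (combine g i)))   ≡⟨ cong from (bits≡ g i) ⟩
      from (to (finToFun s′ (combine g i)))  ≡⟨ strictlyInverseʳ _ ⟩
      finToFun s′ (combine g i)              ∎)
    where
    open Inverse 2↔Bool using (to; from; strictlyInverseʳ)
    open ≡-Reasoning

  σ : Input → List (Point d)
  σ s = requests (bits s)

  tape : Input → Tape
  tape s = oracle (σ s)

  read : Input → ℕ
  read s = proj₂ (run A (tape s) (σ s))

  σ₁ : List (Point d)
  σ₁ = map point phase₁

  labels₁ : Input → List ℕ
  labels₁ s = proj₁ (runFrom A (tape s) [] 0 σ₁)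

  read₁ : Input → ℕ
  read₁ s = proj₂ (runFrom A (tape s) [] 0 σ₁)

  σ-split : ∀ s → σ s ≡ σ₁ ++ map point (phase₂ (bits s))
  σ-split s = map-++ point phase₁ (phase₂ (bits s))

  run-split : ∀ s → Σ (List ℕ) λ rest → proj₁ (run A (tape s) (σ s)) ≡ labels₁ s ++ rest × read₁ s ≤ read s
  run-split s = subst (λ σ′ → Σ (List ℕ) λ rest →
                         proj₁ (runFrom A (tape s) [] 0 σ′) ≡ labels₁ s ++ rest × read₁ s ≤ proj₂ (runFrom A (tape s) [] 0 σ′))
                      (sym (σ-split s)) (runFrom-++ A (tape s) [] 0 σ₁ _)

  occurs₁ : ∀ s {n} → n ∈ phase₁ → ∃ λ a → (point n , a) ∈ zip σ₁ (labels₁ s)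
  occurs₁ s n∈ = ∈-zip⁺ σ₁ (labels₁ s) (∈-map⁺ point n∈) (length-runFrom A (tape s) [] 0 σ₁)

  occurs₁⇒occurs : ∀ s {p} → p ∈ zip σ₁ (labels₁ s) → p ∈ zip (σ s) (proj₁ (run A (tape s) (σ s)))
  occurs₁⇒occurs s {p} p∈ with rest , labels≡ , _ ← run-split s =
    subst (λ ls → p ∈ zip (σ s) ls) (sym labels≡)
      (subst (λ σ′ → p ∈ zip σ′ (labels₁ s ++ rest)) (sym (σ-split s)) (∈-zip-++⁺ˡ σ₁ (labels₁ s) _ rest p∈))

  bit-read-off₁ : ∀ s g i {a b} →
    (point (g , centre) , a) ∈ zip σ₁ (labels₁ s) → (point (g , up i) , b) ∈ zip σ₁ (labels₁ s) →
    bits s g i ≡ does (a ≟ b)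
  bit-read-off₁ s g i c∈ up∈ =
    OptimalClustering.bit-read-off (bits s) axis _ (optimal (σ s)) g i (occurs₁⇒occurs s c∈) (occurs₁⇒occurs s up∈)

  labels₁-injective : ∀ {s s′} → labels₁ s ≡ labels₁ s′ → s ≡ s′
  labels₁-injective {s} {s′} labels≡ = bits-injective λ g i →
    let a , c∈  = occurs₁ s (∈-gadgets⁺ _ {g} (here refl))
        b , up∈ = occurs₁ s (∈-gadgets⁺ _ {g} (there (∈-map⁺ up (∈-allFin i))))
    in trans (bit-read-off₁ s g i c∈ up∈) (sym (bit-read-off₁ s′ g i (transport c∈) (transport up∈)))
    where
    transport : ∀ {p} → p ∈ zip σ₁ (labels₁ s) → p ∈ zip σ₁ (labels₁ s′)
    transport {p} = subst (λ ls → p ∈ zip σ₁ ls) labels≡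

  determined-by-advice : ∀ s s′ → AgreeBelow (read₁ s) (tape s) (tape s′) → s ≡ s′
  determined-by-advice s s′ agree =
    labels₁-injective (sym (cong proj₁ (runFrom-cong A (tape s) (tape s′) [] 0 σ₁ agree)))

  hard-input : Σ Input λ s → m ≤ length (σ s) × d * length (σ s) ≤ (1 + 3 * d) * read s
  hard-input with s , K≤read₁ ← advice-pigeonhole K tape read₁ determined-by-advice
    = s , m≤length , (begin
      d * length (σ s)                    ≡⟨ cong (d *_) (length-requests (bits s)) ⟩
      d * (m * suc d + m * (d * 2))       ≡⟨ regroup m d ⟩
      (1 + 3 * d) * K                     ≤⟨ *-monoʳ-≤ (1 + 3 * d) (≤-trans K≤read₁ (proj₂ (proj₂ (run-split s)))) ⟩
      (1 + 3 * d) * read s                ∎)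
    where
    open ≤-Reasoning
    regroup : ∀ m d → d * (m * suc d + m * (d * 2)) ≡ (1 + 3 * d) * (m * d)
    regroup = solve-∀
    m≤length : m ≤ length (σ s)
    m≤length = subst (m ≤_) (sym (length-requests (bits s))) (≤-trans (m≤m*n m (suc d)) (m≤m+n _ _))

theorem2 : (d : ℕ) → 1 ≤ d →
    (A : OnlineAlg d) → (oracle : List (Point d) → Tape) →
    (∀ σ → Optimal σ (proj₁ (run A (oracle σ) σ))) →
    ∀ N → Σ ℕ λ n → N ≤ n × Σ (List (Point d)) λ σ → length σ ≡ n ×
    d * n ≤ (1 + 3 * d) * proj₂ (run A (oracle σ) σ)
theorem2 zero    ()
theorem2 (suc d) _ A oracle optimal N = length (σ s) , ≤-trans (n≤1+n N) N<n , σ s , refl , bound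
  where
  open LowerBound Fin.zero A oracle optimal (suc N)
  s : Input
  s = proj₁ hard-input
  N<n : suc N ≤ length (σ s)
  N<n = proj₁ (proj₂ hard-input)
  bound : suc d * length (σ s) ≤ (1 + 3 * suc d) * read s
  bound = proj₂ (proj₂ hard-input)
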